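{- Let $D$ be a locatable digraph of order $n$ with $\gamma_{OL}(D)=n$. Then $\mathcal{H}(D)$ is a disjoint union of rooted directed trees, such that for each root $r$, the vertex $f^-(r)$ is domination-forced in $D$ (and thus $r$ has only one in-neighbour in $D$), and for each non-root vertex $v$, the vertex $f^-(v)$ is location-forced in $D$.
   Context: Digraphs are finite and may contain loops; for each ordered pair $(x,y)$ there is at most one arc $xy$. $N^-(v)$ is the set of vertices $u$ such that $uv$ is an arc (including $v$ if $v$ has a loop). An OLD set of $D$ is a set $S\subseteq V(D)$ such that every vertex has an in-neighbour in $S$ and for every two distinct vertices $u,v$, some vertex of $S$ lies in $N^-(u)\ominus N^-(v)$. $D$ is locatable if it admits an OLD set; $\gamma_{OL}(D)$ is the minimum size of an OLD set. A vertex $v$ is domination-forced if some vertex $w$ has $N^-(w)=\{v\}$; location-forced if there are distinct $x,y$ with $N^-(x)\ominus N^-(y)=\{v\}$. An arc $xy$ is forcing if $N^-(y)=\{x\}$ or there is a vertex $z$ with $N^-(y)\ominus N^-(z)=\{x\}$. When $\gamma_{OL}(D)=n$, every vertex $v$ has exactly one incoming forcing arc, and $f^-(v)$ denotes its tail. $\mathcal{H}(D)$ is the digraph on $V(D)$ with an arc from $x$ to $y$ iff there is a location-forced vertex $v$ of $D$ with $N^-(x)=N^-(y)\setminus\{v\}$ (and $v\in N^-(y)$). A rooted directed tree is a loopless digraph whose underlying graph is a tree, with a single vertex of in-degree $0$ (the root) and all arcs oriented away from the root; a single vertex is allowed. -}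

module Defs where

open import Data.Nat using (ℕ; _≤_)
open import Data.Bool using (Bool; true; _xor_)
open import Data.Fin using (Fin)
open import Data.Fin.Subset using (Subset; _∈_; ⁅_⁆; _-_; ∣_∣)
open import Data.Vec using (tabulate; zipWith)
open import Data.Product using (Σ; ∃; ∃-syntax; _×_)
open import Data.Sum using (_⊎_)
open import Relation.Nullary using (¬_)
open import Relation.Binary.PropositionalEquality using (_≡_; _≢_)
open import Relation.Binary.Construct.Closure.ReflexiveTransitive using (Star)

-- A digraph on vertex set Fin n: arc u v ≡ true iff uv is an arc.
-- Loops allowed; at most one arc per ordered pair (Bool-valued).
Digraph : ℕ → Set
Digraph n = Fin n → Fin n → Bool

module _ {n : ℕ} (D : Digraph n) where

  N⁻ : Fin n → Subset n
  N⁻ v = tabulate (λ u → D u v)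

  _⊖_ : Subset n → Subset n → Subset n
  S ⊖ T = zipWith _xor_ S T

  IsOLD : Subset n → Set
  IsOLD S = (∀ v → ∃[ u ] (u ∈ S × u ∈ N⁻ v))
          × (∀ u v → u ≢ v → ∃[ w ] (w ∈ S × w ∈ (N⁻ u ⊖ N⁻ v)))

  Locatable : Set
  Locatable = ∃[ S ] IsOLD S

  -- γ_OL(D) = n : D is locatable and every OLD set has size ≥ n (hence = n)
  γOL≡order : Set
  γOL≡order = Locatable × (∀ S → IsOLD S → n ≤ ∣ S ∣)

  DominationForced : Fin n → Set
  DominationForced v = ∃[ w ] (N⁻ w ≡ ⁅ v ⁆)

  LocationForced : Fin n → Set
  LocationForced v = ∃[ x ] ∃[ y ] (x ≢ y × (N⁻ x ⊖ N⁻ y) ≡ ⁅ v ⁆)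

  ForcingArc : Fin n → Fin n → Set
  ForcingArc x y = D x y ≡ true
                 × (N⁻ y ≡ ⁅ x ⁆ ⊎ ∃[ z ] ((N⁻ y ⊖ N⁻ z) ≡ ⁅ x ⁆))

  𝓗 : Fin n → Fin n → Set
  𝓗 x y = ∃[ v ] (LocationForced v × v ∈ N⁻ y × N⁻ x ≡ (N⁻ y - v))

module _ {n : ℕ} (H : Fin n → Fin n → Set) where

  IsRoot : Fin n → Set
  IsRoot r = ∀ x → ¬ H x r

  DisjointUnionOfRootedTrees : Set
  DisjointUnionOfRootedTrees =
      (∀ x x′ y → H x y → H x′ y → x ≡ x′)
    × (∀ y → ∃[ r ] (IsRoot r × Star H r y))

-- Every vertex l is forced, since otherwise V ∖ {l} would be a smaller OLD set.  Hence
-- the family U = {∅} ∪ {N⁻(v)} of n + 1 subsets of V contains, for each l, a pair T, T ∖ {l}.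
-- As in Bondy's theorem, each such coordinate l added to a set C of coordinates
-- separates at least one more member of U, so a set C separating more than |C| + 1
-- members would force |U| ≥ n + 2.  This makes U a tree rooted at ∅: a member Y cannot
-- lose two different elements a, b inside U (∅, Y ∖ {a}, Y ∖ {b}, Y would take four
-- values on {a, b}), and since the n tops T are then distinct, every nonempty member is
-- one of them.  In 𝓗(D) the arcs into y are exactly these descents N⁻(y) ∖ {r} = N⁻(x),
-- which gives in-degree at most one, and descending strictly shrinks |N⁻| until a
-- vertex with a singleton in-neighbourhood, which is a root.

module Submission where

open import Defs

open import Data.Bool using (true; false; _xor_)
import Data.Bool as Bool
open import Data.Bool.Properties
  using (xor-comm; xor-same; xor-identityʳ; not-involutive; ¬-not; not-¬)
open import Data.Fin using (Fin; zero; suc; _≟_)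
open import Data.Fin.Properties using (any?; all?; ¬∀⟶∃¬; injective⇒≤)
open import Data.Fin.Subset.Induction using (⊃-wellFounded; Acc; acc)
open import Data.Fin.Subset
  using (Subset; ⊥; ⊤; ⁅_⁆; _∪_; _-_; ∁; ∣_∣; _∈_; _∉_; _⊆_; _⊂_; _⊃_)
open import Data.Fin.Subset.Properties
  using (_∈?_; ∉⊥; x∈⁅x⁆; x∈⁅y⁆⇒x≡y; x∉p⇒x∈∁p; ⊆-antisym; ∪-identityˡ; p─⊥≡p;
         ∣∁p∣≡n∸∣p∣; ∣⁅x⁆∣≡1; ∣⊥∣≡0; ∣⊤∣≡n; p⊆q⇒∣p∣≤∣q∣; p⊆p∪q; q⊆p∪q; x∈p∪q⁺; x∈p∪q⁻;
         x∈p⇒∣p-x∣<∣p∣)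
open import Data.Nat using (ℕ; suc; _+_; _∸_; _≤_; _<_)
open import Data.Nat.Induction using (<-wellFounded)
open import Data.Nat.Properties using (n<1+n; ≤-refl; ≤-trans; +-monoʳ-≤; +-suc; <⇒≱)
open import Data.Product using (Σ-syntax; ∃-syntax; _×_; _,_; proj₁)
open import Data.Sum using (_⊎_; inj₁; inj₂; [_,_])
import Data.Vec as Vec
open import Data.Vec using (lookup; zipWith; here; there)
open import Data.Vec.Properties
  using (≡-dec; lookup∘tabulate; []=⇒lookup; lookup⇒[]=; lookup-replicate; zipWith-comm;
         lookup-zipWith)
open import Data.Vec.Relation.Binary.Pointwise.Extensional using (ext; Pointwise-≡⇒≡)
open import Data.Vec.Functional using ([]; _∷_)
open import Function using (_∘_)
open import Function.Definitions using (Injective)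
open import Relation.Nullary using (¬_; Dec; yes; no; contradiction; ¬?; _×-dec_; _→-dec_)
open import Relation.Unary using (Decidable)
open import Relation.Binary.Construct.Closure.ReflexiveTransitive using (Star; ε; _◅_; _◅◅_)
open import Relation.Nullary.Decidable using (decidable-stable; map′)
open import Relation.Binary.PropositionalEquality
  using (_≡_; _≢_; refl; sym; trans; cong; cong₂; subst; module ≡-Reasoning)

private variable
  n : ℕ

subset-ext : {p q : Subset n} → (∀ c → lookup p c ≡ lookup q c) → p ≡ q
subset-ext p≗q = Pointwise-≡⇒≡ (ext p≗q)

lookup-⁅y⁆ : {x y : Fin n} → x ≢ y → lookup ⁅ y ⁆ x ≡ false
lookup-⁅y⁆ {x = zero}  {zero}  x≢y = contradiction refl x≢y
lookup-⁅y⁆ {x = zero}  {suc y} _   = refl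
lookup-⁅y⁆ {x = suc x} {zero}  _   = lookup-replicate x false
lookup-⁅y⁆ {x = suc x} {suc y} x≢y = lookup-⁅y⁆ (x≢y ∘ cong suc)

lookup-p-x : (p : Subset n) (x : Fin n) → lookup (p - x) x ≡ false
lookup-p-x (_ Vec.∷ _) zero    = refl
lookup-p-x (_ Vec.∷ p) (suc x) = lookup-p-x p x

lookup-p-y : (p : Subset n) {x y : Fin n} → x ≢ y → lookup (p - y) x ≡ lookup p x
lookup-p-y (_ Vec.∷ _) {zero}  {zero}  x≢y = contradiction refl x≢y
lookup-p-y (_ Vec.∷ _) {zero}  {suc y} _   = refl
lookup-p-y (_ Vec.∷ p) {suc x} {zero}  _   = cong (λ r → lookup r x) (p─⊥≡p p)
lookup-p-y (_ Vec.∷ p) {suc x} {suc y} x≢y = lookup-p-y p (x≢y ∘ cong suc)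

xor-solve : ∀ a {b d} → a xor b ≡ d → b ≡ a xor d
xor-solve false refl = refl
xor-solve true {b} refl = sym (not-involutive b)

∉⇒lookup≡false : {x : Fin n} {p : Subset n} → x ∉ p → lookup p x ≡ false
∉⇒lookup≡false {x = x} {p} x∉p = ¬-not (x∉p ∘ lookup⇒[]= x p)

lookup-xor : {p q r : Subset n} → zipWith _xor_ p q ≡ r →
             ∀ c → lookup p c xor lookup q c ≡ lookup r c
lookup-xor {p = p} {q} eq c = trans (sym (lookup-zipWith _xor_ c p q)) (cong (λ s → lookup s c) eq)

x∉xor-self : {x : Fin n} (p : Subset n) → x ∉ zipWith _xor_ p p
x∉xor-self {x = x} p x∈ with () ← trans (sym ([]=⇒lookup x∈))
  (trans (lookup-zipWith _xor_ x p p) (xor-same (lookup p x)))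

module _ {x : Fin n} {p : Subset n} where
  open ≡-Reasoning

  xor≡⁅x⁆⇒p-x≡q : {q : Subset n} → zipWith _xor_ p q ≡ ⁅ x ⁆ → x ∈ p → p - x ≡ q
  xor≡⁅x⁆⇒p-x≡q {q} Δ≡⁅x⁆ x∈p = subset-ext pointwise
    where
    q≗ : ∀ c → lookup q c ≡ lookup p c xor lookup ⁅ x ⁆ c
    q≗ c = xor-solve (lookup p c) (lookup-xor Δ≡⁅x⁆ c)
    pointwise : ∀ c → lookup (p - x) c ≡ lookup q c
    pointwise c with c ≟ x
    ... | yes refl = begin
      lookup (p - x) x                 ≡⟨ lookup-p-x p x ⟩
      true xor true                    ≡⟨ cong₂ _xor_ ([]=⇒lookup x∈p) ([]=⇒lookup (x∈⁅x⁆ x)) ⟨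
      lookup p x xor lookup ⁅ x ⁆ x    ≡⟨ q≗ x ⟨
      lookup q x                       ∎
    ... | no c≢x = begin
      lookup (p - x) c                 ≡⟨ lookup-p-y p c≢x ⟩
      lookup p c                       ≡⟨ xor-identityʳ (lookup p c) ⟨
      lookup p c xor false             ≡⟨ cong (lookup p c xor_) (lookup-⁅y⁆ c≢x) ⟨
      lookup p c xor lookup ⁅ x ⁆ c    ≡⟨ q≗ c ⟨
      lookup q c                       ∎

  x∈p⇒xor-p-x≡⁅x⁆ : x ∈ p → zipWith _xor_ p (p - x) ≡ ⁅ x ⁆
  x∈p⇒xor-p-x≡⁅x⁆ x∈p = subset-ext pointwise
    where
    pointwise : ∀ c → lookup (zipWith _xor_ p (p - x)) c ≡ lookup ⁅ x ⁆ c
    pointwise c with c ≟ x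
    ... | yes refl = begin
      lookup (zipWith _xor_ p (p - x)) x  ≡⟨ lookup-zipWith _xor_ x p (p - x) ⟩
      lookup p x xor lookup (p - x) x     ≡⟨ cong₂ _xor_ ([]=⇒lookup x∈p) (lookup-p-x p x) ⟩
      true                                ≡⟨ []=⇒lookup (x∈⁅x⁆ x) ⟨
      lookup ⁅ x ⁆ x                      ∎
    ... | no c≢x = begin
      lookup (zipWith _xor_ p (p - x)) c  ≡⟨ lookup-zipWith _xor_ c p (p - x) ⟩
      lookup p c xor lookup (p - x) c     ≡⟨ cong (lookup p c xor_) (lookup-p-y p c≢x) ⟩
      lookup p c xor lookup p c           ≡⟨ xor-same (lookup p c) ⟩
      false                               ≡⟨ lookup-⁅y⁆ c≢x ⟨
      lookup ⁅ x ⁆ c                      ∎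

  p-x≡⊥⇒p≡⁅x⁆ : x ∈ p → p - x ≡ ⊥ → p ≡ ⁅ x ⁆
  p-x≡⊥⇒p≡⁅x⁆ x∈p p-x≡⊥ = subset-ext pointwise
    where
    pointwise : ∀ c → lookup p c ≡ lookup ⁅ x ⁆ c
    pointwise c with c ≟ x
    ... | yes refl = trans ([]=⇒lookup x∈p) (sym ([]=⇒lookup (x∈⁅x⁆ x)))
    ... | no c≢x = begin
      lookup p c        ≡⟨ lookup-p-y p c≢x ⟨
      lookup (p - x) c  ≡⟨ cong (λ s → lookup s c) p-x≡⊥ ⟩
      lookup ⊥ c        ≡⟨ lookup-replicate c false ⟩
      false             ≡⟨ lookup-⁅y⁆ c≢x ⟨
      lookup ⁅ x ⁆ c    ∎

xor≡⁅x⁆⇒p-x≡q⊎q-x≡p : {x : Fin n} {p q : Subset n} → zipWith _xor_ p q ≡ ⁅ x ⁆ →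
                  (x ∈ p × p - x ≡ q) ⊎ (x ∈ q × q - x ≡ p)
xor≡⁅x⁆⇒p-x≡q⊎q-x≡p {x = x} {p} {q} Δ≡⁅x⁆ with x ∈? p
... | yes x∈p = inj₁ (x∈p , xor≡⁅x⁆⇒p-x≡q Δ≡⁅x⁆ x∈p)
... | no x∉p = inj₂ (x∈q , xor≡⁅x⁆⇒p-x≡q ∇≡⁅x⁆ x∈q)
  where
  ∇≡⁅x⁆ : zipWith _xor_ q p ≡ ⁅ x ⁆
  ∇≡⁅x⁆ = trans (zipWith-comm xor-comm q p) Δ≡⁅x⁆
  x∈q : x ∈ q
  x∈q = lookup⇒[]= x q (begin
    lookup q x                     ≡⟨ xor-solve (lookup p x) (lookup-xor Δ≡⁅x⁆ x) ⟩
    lookup p x xor lookup ⁅ x ⁆ x  ≡⟨ cong₂ _xor_ (∉⇒lookup≡false x∉p) ([]=⇒lookup (x∈⁅x⁆ x)) ⟩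
    true                           ∎)
    where open ≡-Reasoning

⁅x⁆-x≡⊥ : (x : Fin n) → ⁅ x ⁆ - x ≡ ⊥
⁅x⁆-x≡⊥ x = subset-ext pointwise
  where
  pointwise : ∀ c → lookup (⁅ x ⁆ - x) c ≡ lookup ⊥ c
  pointwise c with c ≟ x
  ... | yes refl = trans (lookup-p-x ⁅ x ⁆ x) (sym (lookup-replicate x false))
  ... | no c≢x = trans (lookup-p-y ⁅ x ⁆ c≢x)
                       (trans (lookup-⁅y⁆ c≢x) (sym (lookup-replicate c false)))

∣⁅x⁆∪p∣≡1+∣p∣ : {x : Fin n} (p : Subset n) → x ∉ p → ∣ ⁅ x ⁆ ∪ p ∣ ≡ suc ∣ p ∣
∣⁅x⁆∪p∣≡1+∣p∣ {x = zero}  (true  Vec.∷ p) x∉p = contradiction here x∉p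
∣⁅x⁆∪p∣≡1+∣p∣ {x = zero}  (false Vec.∷ p) _   = cong (suc ∘ ∣_∣) (∪-identityˡ p)
∣⁅x⁆∪p∣≡1+∣p∣ {x = suc x} (true  Vec.∷ p) x∉p = cong suc (∣⁅x⁆∪p∣≡1+∣p∣ p (x∉p ∘ there))
∣⁅x⁆∪p∣≡1+∣p∣ {x = suc x} (false Vec.∷ p) x∉p = ∣⁅x⁆∪p∣≡1+∣p∣ p (x∉p ∘ there)

b∉⁅a⁆∪⊥ : {a b : Fin n} → a ≢ b → b ∉ ⁅ a ⁆ ∪ ⊥
b∉⁅a⁆∪⊥ {a = a} a≢b = [ a≢b ∘ sym ∘ x∈⁅y⁆⇒x≡y a , ∉⊥ ] ∘ x∈p∪q⁻ ⁅ a ⁆ ⊥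

∣⁅b⁆∪⁅a⁆∪⊥∣≡2 : {a b : Fin n} → a ≢ b → ∣ ⁅ b ⁆ ∪ ⁅ a ⁆ ∪ ⊥ ∣ ≡ 2
∣⁅b⁆∪⁅a⁆∪⊥∣≡2 {n} {a} {b} a≢b = begin
  ∣ ⁅ b ⁆ ∪ ⁅ a ⁆ ∪ ⊥ ∣  ≡⟨ ∣⁅x⁆∪p∣≡1+∣p∣ (⁅ a ⁆ ∪ ⊥) (b∉⁅a⁆∪⊥ a≢b) ⟩
  suc ∣ ⁅ a ⁆ ∪ ⊥ ∣      ≡⟨ cong (1 +_) (∣⁅x⁆∪p∣≡1+∣p∣ {x = a} ⊥ ∉⊥) ⟩
  suc (suc ∣ ⊥ {n} ∣)    ≡⟨ cong (2 +_) (∣⊥∣≡0 n) ⟩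
  2                      ∎
  where open ≡-Reasoning

∣∁⁅x⁆∣<n : (x : Fin n) → ∣ ∁ ⁅ x ⁆ ∣ < n
∣∁⁅x⁆∣<n {suc k} x = subst (_< suc k) (sym ∣∁⁅x⁆∣≡k) (n<1+n k)
  where
  ∣∁⁅x⁆∣≡k : ∣ ∁ ⁅ x ⁆ ∣ ≡ k
  ∣∁⁅x⁆∣≡k = trans (∣∁p∣≡n∸∣p∣ ⁅ x ⁆) (cong (suc k ∸_) (∣⁅x⁆∣≡1 x))

x∈p∧p≢⁅y⁆⇒∃∈∁⁅y⁆ : {x u : Fin n} {p : Subset n} → u ∈ p → p ≢ ⁅ x ⁆ → ∃[ w ] (w ∈ ∁ ⁅ x ⁆ × w ∈ p)
x∈p∧p≢⁅y⁆⇒∃∈∁⁅y⁆ {x = x} {u} {p} u∈p p≢⁅x⁆ with any? (λ w → w ∈? ∁ ⁅ x ⁆ ×-dec w ∈? p)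
... | yes found = found
... | no none = contradiction (⊆-antisym p⊆⁅x⁆ ⁅x⁆⊆p) p≢⁅x⁆
  where
  p⊆⁅x⁆ : p ⊆ ⁅ x ⁆
  p⊆⁅x⁆ {w} w∈p = decidable-stable (w ∈? ⁅ x ⁆) (λ w∉ → none (w , x∉p⇒x∈∁p w∉ , w∈p))
  ⁅x⁆⊆p : ⁅ x ⁆ ⊆ p
  ⁅x⁆⊆p w∈⁅x⁆ = subst (_∈ p) (trans (x∈⁅y⁆⇒x≡y x (p⊆⁅x⁆ u∈p)) (sym (x∈⁅y⁆⇒x≡y x w∈⁅x⁆))) u∈p

∷-preserves-injective : ∀ {a} {A : Set a} {k} {x : A} {f : Fin k → A} →
                        (∀ i → f i ≢ x) → Injective _≡_ _≡_ f → Injective _≡_ _≡_ (x ∷ f)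
∷-preserves-injective x∉f f-inj {zero}  {zero}  _  = refl
∷-preserves-injective x∉f f-inj {zero}  {suc j} eq = contradiction (sym eq) (x∉f j)
∷-preserves-injective x∉f f-inj {suc i} {zero}  eq = contradiction eq (x∉f i)
∷-preserves-injective x∉f f-inj {suc i} {suc j} eq = cong suc (f-inj eq)

infix 4 _≈[_]_

record _≈[_]_ {n} (X C Y : Subset n) : Set where
  constructor agree
  field at : ∀ c → c ∈ C → lookup X c ≡ lookup Y c
open _≈[_]_

≈-sym : {X Y C : Subset n} → X ≈[ C ] Y → Y ≈[ C ] X
≈-sym X≈Y = agree λ c c∈C → sym (at X≈Y c c∈C)

≈-trans : {X Y Z C : Subset n} → X ≈[ C ] Y → Y ≈[ C ] Z → X ≈[ C ] Z
≈-trans X≈Y Y≈Z = agree λ c c∈C → trans (at X≈Y c c∈C) (at Y≈Z c c∈C)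

≈-restrict : {X Y C C′ : Subset n} → C ⊆ C′ → X ≈[ C′ ] Y → X ≈[ C ] Y
≈-restrict C⊆C′ X≈Y = agree λ c c∈C → at X≈Y c (C⊆C′ c∈C)

≉-at : {X Y C : Subset n} {c : Fin n} →
       c ∈ C → lookup X c ≡ false → lookup Y c ≡ true → ¬ X ≈[ C ] Y
≉-at c∈C X[c]≡false Y[c]≡true X≈Y = not-¬ X[c]≡false (trans (at X≈Y _ c∈C) Y[c]≡true)

≈-dec : (X C Y : Subset n) → Dec (X ≈[ C ] Y)
≈-dec X C Y = map′ agree at (all? (λ c → c ∈? C →-dec lookup X c Bool.≟ lookup Y c))

module Separation {m n : ℕ} (U : Fin m → Subset n) where

  Separates : Subset n → ∀ {k} → (Fin k → Fin m) → Set
  Separates C F = ∀ i j → U (F i) ≈[ C ] U (F j) → i ≡ j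

  Separated : Subset n → ℕ → Set
  Separated C k = Σ[ F ∈ (Fin k → Fin m) ] Separates C F

  separated⇒≤ : ∀ {C k} → Separated C k → k ≤ m
  separated⇒≤ (F , sep) = injective⇒≤ λ {i} {j} Fi≡Fj →
    sep i j (agree λ c _ → cong (λ r → lookup (U r) c) Fi≡Fj)

  single-separates : ∀ {C} y → Separates C (y ∷ [])
  single-separates y zero zero _ = refl

  widen : ∀ {C C′ k} {F : Fin k → Fin m} → C ⊆ C′ → Separates C F → Separates C′ F
  widen C⊆C′ sep i j = sep i j ∘ ≈-restrict C⊆C′

  add-fresh : ∀ {C k e} {F : Fin k → Fin m} →
              (∀ q → ¬ U e ≈[ C ] U (F q)) → Separates C F → Separates C (e ∷ F)
  add-fresh fresh sep zero    zero     _ = refl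
  add-fresh fresh sep zero    (suc q)  e≈q = contradiction e≈q (fresh q)
  add-fresh fresh sep (suc q) zero     q≈e = contradiction (≈-sym q≈e) (fresh q)
  add-fresh fresh sep (suc q) (suc q′) q≈q′ = cong suc (sep q q′ q≈q′)

  add-split : ∀ {C k e p l} {F : Fin k → Fin m} →
              U e ≈[ C ] U (F p) → ¬ U e ≈[ ⁅ l ⁆ ] U (F p) →
              Separates C F → Separates (⁅ l ⁆ ∪ C) (e ∷ F)
  add-split {C} {e = e} {p} {l} {F} e≈p e≉ₗp sep =
    add-fresh fresh (widen (q⊆p∪q ⁅ l ⁆ C) sep)
    where
    fresh : ∀ q → ¬ U e ≈[ ⁅ l ⁆ ∪ C ] U (F q)
    fresh q e≈q with sep p q (≈-trans (≈-sym e≈p) (≈-restrict (q⊆p∪q ⁅ l ⁆ C) e≈q))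
    ... | refl = e≉ₗp (≈-restrict (p⊆p∪q C) e≈q)

  record Edge (l : Fin n) : Set where
    constructor mkEdge
    field
      bottom top   : Fin m
      l∈top        : l ∈ U top
      bottom≡top-l : U bottom ≡ U top - l

    bottom[l]≡false : lookup (U bottom) l ≡ false
    bottom[l]≡false = trans (cong (λ X → lookup X l) bottom≡top-l) (lookup-p-x (U top) l)

    bottom≈top : ∀ {C} → l ∉ C → U bottom ≈[ C ] U top
    bottom≈top l∉C = agree λ c c∈C → trans (cong (λ X → lookup X c) bottom≡top-l)
                                           (lookup-p-y (U top) (λ { refl → l∉C c∈C }))

  module _ {C l} (l∉C : l ∉ C) (E : Edge l) where
    open Edge E

    extend : ∀ {k} → Separated C k → Separated (⁅ l ⁆ ∪ C) (suc k)
    extend (F , sep) with any? (λ p → ≈-dec (U top) C (U (F p)))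
    ... | no top-fresh =
      top ∷ F , add-fresh (λ q top≈q → top-fresh (q , ≈-restrict (q⊆p∪q ⁅ l ⁆ C) top≈q))
                          (widen (q⊆p∪q ⁅ l ⁆ C) sep)
    ... | yes (p , top≈p) with lookup (U (F p)) l in p[l]
    ...   | true  = bottom ∷ F , add-split {p = p} (≈-trans (bottom≈top l∉C) top≈p)
                                           (≉-at (x∈⁅x⁆ l) bottom[l]≡false p[l]) sep
    ...   | false = top ∷ F , add-split {p = p} top≈p
                                        (≉-at (x∈⁅x⁆ l) p[l] ([]=⇒lookup l∈top) ∘ ≈-sym) sep

  -- ⊥, Y - b, Y - a and Y realise all four patterns on {a, b}.
  two-descents-separate : ∀ {o y i j a b} → U o ≡ ⊥ → a ≢ b → a ∈ U y → b ∈ U y →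
                          U i ≡ U y - a → U j ≡ U y - b →
                          Separated (⁅ b ⁆ ∪ ⁅ a ⁆ ∪ ⊥) 4
  two-descents-separate {o} {y} {i} {j} {a} {b} U-o≡⊥ a≢b a∈y b∈y i≡y-a j≡y-b =
    o ∷ j ∷ i ∷ y ∷ [] , add-fresh ⊥-fresh sep₃
    where
    Eᵃ : Edge a
    Eᵃ = mkEdge i y a∈y i≡y-a
    Eᵇ : Edge b
    Eᵇ = mkEdge j y b∈y j≡y-b
    open Edge
    y[a] : lookup (U y) a ≡ true
    y[a] = []=⇒lookup a∈y
    y[b] : lookup (U y) b ≡ true
    y[b] = []=⇒lookup b∈y
    o[c]≡false : ∀ c → lookup (U o) c ≡ false
    o[c]≡false c = trans (cong (λ X → lookup X c) U-o≡⊥) (lookup-replicate c false)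
    a∈C : a ∈ ⁅ b ⁆ ∪ ⁅ a ⁆ ∪ ⊥
    a∈C = x∈p∪q⁺ (inj₂ (x∈p∪q⁺ (inj₁ (x∈⁅x⁆ a))))
    b∈C : b ∈ ⁅ b ⁆ ∪ ⁅ a ⁆ ∪ ⊥
    b∈C = x∈p∪q⁺ (inj₁ (x∈⁅x⁆ b))
    sep₂ : Separates (⁅ a ⁆ ∪ ⊥) (i ∷ y ∷ [])
    sep₂ = add-split {p = zero} (bottom≈top Eᵃ ∉⊥)
             (≉-at (x∈⁅x⁆ a) (bottom[l]≡false Eᵃ) y[a]) (single-separates y)
    sep₃ : Separates (⁅ b ⁆ ∪ ⁅ a ⁆ ∪ ⊥) (j ∷ i ∷ y ∷ [])
    sep₃ = add-split {p = suc zero} (bottom≈top Eᵇ (b∉⁅a⁆∪⊥ a≢b))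
             (≉-at (x∈⁅x⁆ b) (bottom[l]≡false Eᵇ) y[b]) sep₂
    ⊥-fresh : ∀ q → ¬ U o ≈[ ⁅ b ⁆ ∪ ⁅ a ⁆ ∪ ⊥ ] U ((j ∷ i ∷ y ∷ []) q)
    ⊥-fresh zero = ≉-at a∈C (o[c]≡false a)
      (trans (at (bottom≈top Eᵇ (a≢b ∘ sym ∘ x∈⁅y⁆⇒x≡y a)) a (x∈⁅x⁆ a)) y[a])
    ⊥-fresh (suc zero) = ≉-at b∈C (o[c]≡false b)
      (trans (at (bottom≈top Eᵃ (a≢b ∘ x∈⁅y⁆⇒x≡y b)) b (x∈⁅x⁆ b)) y[b])
    ⊥-fresh (suc (suc zero)) = ≉-at a∈C (o[c]≡false a) y[a]

  module Irreducible (edge : ∀ l → Edge l) where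

    -- Each coordinate outside C has an edge and so separates one more member.
    separation-bound : ∀ {C e} → Separated C (e + ∣ C ∣) → e + n ≤ m
    separation-bound {C} = go C (⊃-wellFounded C)
      where
      go : ∀ C → Acc _⊃_ C → ∀ {e} → Separated C (e + ∣ C ∣) → e + n ≤ m
      go C (acc larger) {e} sep with all? (_∈? C)
      ... | yes all∈C = ≤-trans (+-monoʳ-≤ e n≤∣C∣) (separated⇒≤ sep)
        where
        n≤∣C∣ : n ≤ ∣ C ∣
        n≤∣C∣ = subst (_≤ ∣ C ∣) (∣⊤∣≡n n) (p⊆q⇒∣p∣≤∣q∣ {p = ⊤} (λ {x} _ → all∈C x))
      ... | no ¬all∈C with ¬∀⟶∃¬ n (_∈ C) (_∈? C) ¬all∈C
      ...   | l , l∉C =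
        go (⁅ l ⁆ ∪ C) (larger C⊂⁅l⁆∪C) (subst (Separated _) size (extend l∉C (edge l) sep))
        where
        C⊂⁅l⁆∪C : C ⊂ ⁅ l ⁆ ∪ C
        C⊂⁅l⁆∪C = q⊆p∪q ⁅ l ⁆ C , l , x∈p∪q⁺ (inj₁ (x∈⁅x⁆ l)) , l∉C
        size : suc (e + ∣ C ∣) ≡ e + ∣ ⁅ l ⁆ ∪ C ∣
        size = trans (sym (+-suc e ∣ C ∣)) (cong (e +_) (sym (∣⁅x⁆∪p∣≡1+∣p∣ C l∉C)))

    module Critical {o} (U-o≡⊥ : U o ≡ ⊥) (m≤1+n : m ≤ suc n) where
      open Edge

      unique-descent : ∀ {y i j a b} → a ∈ U y → b ∈ U y →
                       U i ≡ U y - a → U j ≡ U y - b → a ≡ b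
      unique-descent {a = a} {b} a∈y b∈y i≡y-a j≡y-b with a ≟ b
      ... | yes a≡b = a≡b
      ... | no a≢b = contradiction m≤1+n (<⇒≱ (separation-bound
        (subst (Separated _) (cong (2 +_) (sym (∣⁅b⁆∪⁅a⁆∪⊥∣≡2 a≢b)))
               (two-descents-separate U-o≡⊥ a≢b a∈y b∈y i≡y-a j≡y-b))))

      -- The n tops are distinct members other than U o, so they exhaust U.
      descent : ∀ y → y ≢ o → ∃[ l ] (l ∈ U y × ∃[ i ] U i ≡ U y - l)
      descent y y≢o with any? (λ l → top (edge l) ≟ y)
      ... | yes (l , refl) = l , l∈top (edge l) , bottom (edge l) , bottom≡top-l (edge l)
      ... | no y∉tops = contradiction m≤1+n (<⇒≱ (injective⇒≤
              (∷-preserves-injective y-new (∷-preserves-injective o-new tops-injective))))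
        where
        tops : Fin n → Fin m
        tops l = top (edge l)
        tops-injective : Injective _≡_ _≡_ tops
        tops-injective {a} {b} eq = unique-descent (l∈top (edge a))
          (subst (λ t → b ∈ U t) (sym eq) (l∈top (edge b)))
          (bottom≡top-l (edge a))
          (subst (λ t → U (bottom (edge b)) ≡ U t - b) (sym eq) (bottom≡top-l (edge b)))
        o-new : ∀ l → tops l ≢ o
        o-new l eq = ∉⊥ (subst (l ∈_) U-o≡⊥ (subst (λ t → l ∈ U t) eq (l∈top (edge l))))
        y-new : ∀ k → (o ∷ tops) k ≢ y
        y-new zero    = y≢o ∘ sym
        y-new (suc l) = y∉tops ∘ (l ,_)

module _ {n : ℕ} (D : Digraph n) where

  arc⇒∈N⁻ : ∀ {x y} → D x y ≡ true → x ∈ N⁻ D y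
  arc⇒∈N⁻ {x} {y} xy = lookup⇒[]= x (N⁻ D y) (trans (lookup∘tabulate (λ u → D u y) x) xy)

  ⊖≡⁅x⁆⇒≢ : ∀ {x y z} → _⊖_ D (N⁻ D y) (N⁻ D z) ≡ ⁅ x ⁆ → y ≢ z
  ⊖≡⁅x⁆⇒≢ {x} {y} Δ≡⁅x⁆ refl = x∉xor-self (N⁻ D y) (subst (x ∈_) (sym Δ≡⁅x⁆) (x∈⁅x⁆ x))

  N⁻-nonempty : Locatable D → ∀ w → N⁻ D w ≢ ⊥
  N⁻-nonempty (_ , dominating , _) w N⁻w≡⊥ with dominating w
  ... | u , _ , u∈w = ∉⊥ (subst (u ∈_) N⁻w≡⊥ u∈w)

  N⁻-injective : Locatable D → ∀ {x y} → N⁻ D x ≡ N⁻ D y → x ≡ y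
  N⁻-injective (_ , _ , locating) {x} {y} N⁻x≡N⁻y with x ≟ y
  ... | yes x≡y = x≡y
  ... | no x≢y with locating x y x≢y
  ...   | u , _ , u∈Δ = contradiction (subst (λ X → u ∈ _⊖_ D X (N⁻ D y)) N⁻x≡N⁻y u∈Δ)
                                      (x∉xor-self (N⁻ D y))

  dominationForced? : Decidable (DominationForced D)
  dominationForced? v = any? (λ w → ≡-dec Bool._≟_ (N⁻ D w) ⁅ v ⁆)

  locationForced? : Decidable (LocationForced D)
  locationForced? v = any? λ x → any? λ y →
    ¬? (x ≟ y) ×-dec ≡-dec Bool._≟_ (_⊖_ D (N⁻ D x) (N⁻ D y)) ⁅ v ⁆

  unforced-removable : Locatable D → ∀ {v} → ¬ DominationForced D v → ¬ LocationForced D v →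
                       IsOLD D (∁ ⁅ v ⁆)
  unforced-removable (_ , dominating , locating) ¬dom ¬loc =
      (λ w → let u , _ , u∈w = dominating w in x∈p∧p≢⁅y⁆⇒∃∈∁⁅y⁆ u∈w (¬dom ∘ (w ,_)))
    , (λ x y x≢y → let u , _ , u∈Δ = locating x y x≢y in
                   x∈p∧p≢⁅y⁆⇒∃∈∁⁅y⁆ u∈Δ (¬loc ∘ λ Δ≡⁅v⁆ → x , y , x≢y , Δ≡⁅v⁆))

  every-vertex-forced : γOL≡order D → ∀ v → DominationForced D v ⊎ LocationForced D v
  every-vertex-forced (locatable , minimum) v with dominationForced? v | locationForced? v
  ... | yes dom | _       = inj₁ dom
  ... | no _    | yes loc = inj₂ loc
  ... | no ¬dom | no ¬loc =
    contradiction (minimum _ (unforced-removable locatable ¬dom ¬loc)) (<⇒≱ (∣∁⁅x⁆∣<n v))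

module ForcingStructure {n : ℕ} (D : Digraph n) (γ≡n : γOL≡order D) where

  family : Fin (suc n) → Subset n
  family = ⊥ ∷ N⁻ D

  open Separation family

  forced-edge : ∀ l → Edge l
  forced-edge l with every-vertex-forced D γ≡n l
  ... | inj₁ (w , N⁻w≡⁅l⁆) =
    mkEdge zero (suc w) (subst (l ∈_) (sym N⁻w≡⁅l⁆) (x∈⁅x⁆ l))
           (sym (trans (cong (_- l) N⁻w≡⁅l⁆) (⁅x⁆-x≡⊥ l)))
  ... | inj₂ (x , y , _ , Δ≡⁅l⁆) with xor≡⁅x⁆⇒p-x≡q⊎q-x≡p Δ≡⁅l⁆
  ...   | inj₁ (l∈x , x-l≡y) = mkEdge (suc y) (suc x) l∈x (sym x-l≡y)
  ...   | inj₂ (l∈y , y-l≡x) = mkEdge (suc x) (suc y) l∈y (sym y-l≡x)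

  open Irreducible.Critical forced-edge {o = zero} refl ≤-refl

  private
    locatable : Locatable D
    locatable = proj₁ γ≡n

  𝓗-intro : ∀ {r y z} → r ∈ N⁻ D y → N⁻ D y - r ≡ N⁻ D z → 𝓗 D z y
  𝓗-intro {r} {y} {z} r∈y y-r≡z = r , (y , z , ⊖≡⁅x⁆⇒≢ D Δ≡⁅r⁆ , Δ≡⁅r⁆) , r∈y , sym y-r≡z
    where
    Δ≡⁅r⁆ : _⊖_ D (N⁻ D y) (N⁻ D z) ≡ ⁅ r ⁆
    Δ≡⁅r⁆ = subst (λ Z → zipWith _xor_ (N⁻ D y) Z ≡ ⁅ r ⁆) y-r≡z (x∈p⇒xor-p-x≡⁅x⁆ r∈y)

  singleton⇒root : ∀ {y r} → N⁻ D y ≡ ⁅ r ⁆ → IsRoot (𝓗 D) y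
  singleton⇒root {y} {r} N⁻y≡⁅r⁆ x (v , _ , v∈y , x≡y-v) = N⁻-nonempty D locatable x (begin
    N⁻ D x        ≡⟨ x≡y-v ⟩
    N⁻ D y - v    ≡⟨ cong₂ _-_ N⁻y≡⁅r⁆ (x∈⁅y⁆⇒x≡y r (subst (v ∈_) N⁻y≡⁅r⁆ v∈y)) ⟩
    ⁅ r ⁆ - r     ≡⟨ ⁅x⁆-x≡⊥ r ⟩
    ⊥             ∎)
    where open ≡-Reasoning

  root-or-child : ∀ y → (∃[ r ] N⁻ D y ≡ ⁅ r ⁆) ⊎ (∃[ z ] (𝓗 D z y × ∣ N⁻ D z ∣ < ∣ N⁻ D y ∣))
  root-or-child y with descent (suc y) (λ ())
  ... | r , r∈y , zero  , ⊥≡y-r = inj₁ (r , p-x≡⊥⇒p≡⁅x⁆ r∈y (sym ⊥≡y-r))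
  ... | r , r∈y , suc z , z≡y-r = inj₂ (z , 𝓗-intro r∈y (sym z≡y-r) ,
    subst (λ Z → ∣ Z ∣ < ∣ N⁻ D y ∣) (sym z≡y-r) (x∈p⇒∣p-x∣<∣p∣ r∈y))

  𝓗-functional : ∀ {x x′ y} → 𝓗 D x y → 𝓗 D x′ y → x ≡ x′
  𝓗-functional {x} {x′} {y} (v , _ , v∈y , x≡y-v) (v′ , _ , v′∈y , x′≡y-v′)
    with unique-descent {y = suc y} {i = suc x} {j = suc x′} v∈y v′∈y x≡y-v x′≡y-v′
  ... | refl = N⁻-injective D locatable (trans x≡y-v (sym x′≡y-v′))

  reachable-from-root : ∀ y → ∃[ r ] (IsRoot (𝓗 D) r × Star (𝓗 D) r y)
  reachable-from-root y = go y (<-wellFounded ∣ N⁻ D y ∣)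
    where
    go : ∀ y → Acc _<_ ∣ N⁻ D y ∣ → ∃[ r ] (IsRoot (𝓗 D) r × Star (𝓗 D) r y)
    go y (acc smaller) with root-or-child y
    ... | inj₁ (_ , N⁻y≡⁅r⁆) = y , singleton⇒root N⁻y≡⁅r⁆ , ε
    ... | inj₂ (z , z→y , ∣z∣<∣y∣) with go z (smaller ∣z∣<∣y∣)
    ...   | r , r-root , r⇝z = r , r-root , r⇝z ◅◅ (z→y ◅ ε)

  root-in-degree : ∀ r → IsRoot (𝓗 D) r → ∣ N⁻ D r ∣ ≡ 1
  root-in-degree r r-root with root-or-child r
  ... | inj₁ (x , N⁻r≡⁅x⁆) = trans (cong ∣_∣ N⁻r≡⁅x⁆) (∣⁅x⁆∣≡1 x)
  ... | inj₂ (z , z→r , _) = contradiction z→r (r-root z)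

  forcing-into-root : ∀ r → IsRoot (𝓗 D) r → ∀ x → ForcingArc D x r → DominationForced D x
  forcing-into-root r _      x (_  , inj₁ N⁻r≡⁅x⁆) = r , N⁻r≡⁅x⁆
  forcing-into-root r r-root x (xr , inj₂ (z , Δ≡⁅x⁆)) =
    contradiction (𝓗-intro x∈r (xor≡⁅x⁆⇒p-x≡q Δ≡⁅x⁆ x∈r)) (r-root z)
    where
    x∈r = arc⇒∈N⁻ D xr

  forcing-into-non-root : ∀ v → ¬ IsRoot (𝓗 D) v → ∀ x → ForcingArc D x v → LocationForced D x
  forcing-into-non-root v non-root x (_ , inj₁ N⁻v≡⁅x⁆) =
    contradiction (singleton⇒root N⁻v≡⁅x⁆) non-root
  forcing-into-non-root v _        x (_ , inj₂ (z , Δ≡⁅x⁆)) = v , z , ⊖≡⁅x⁆⇒≢ D Δ≡⁅x⁆ , Δ≡⁅x⁆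

theorem2p14 : (n : ℕ) (D : Digraph n) → γOL≡order D →
    DisjointUnionOfRootedTrees (𝓗 D)
    × (∀ r → IsRoot (𝓗 D) r →
         (∀ x → ForcingArc D x r → DominationForced D x) × ∣ N⁻ D r ∣ ≡ 1)
    × (∀ v → ¬ IsRoot (𝓗 D) v →
         ∀ x → ForcingArc D x v → LocationForced D x)
theorem2p14 n D γ≡n =
    ((λ _ _ _ → 𝓗-functional) , reachable-from-root)
  , (λ r r-root → forcing-into-root r r-root , root-in-degree r r-root)
  , forcing-into-non-root
  where open ForcingStructure D γ≡n
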